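{- If $\mathsf{LNS}_\mathsf{Kt}$ is cut-free complete for $\mathsf{Kt}$, then so is $\mathsf{LNS}_\mathsf{Kt}^*$.
   Context: Formulae of tense logic $\mathsf{Kt}$ are built from atoms $p$ by $A := p \mid \bot \mid A \to A \mid \Box A \mid \Diamond A \mid \blacksquare A \mid \Diamond^{ -1} A$, where $\Diamond^{ -1}$ denotes the backwards (past) diamond, dual of $\blacksquare$; $\mathsf{Kt}$ is the set of formulae valid in all Kripke models ($\Box,\Diamond$ over $R$-successors, $\blacksquare,\Diamond^{ -1}$ over $R$-predecessors). A linear nested sequent is given by $S := \Gamma\Rightarrow\Delta \mid \Gamma\Rightarrow\Delta \nearrow S \mid \Gamma\Rightarrow\Delta \swarrow S$ with $\Gamma,\Delta$ finite multisets of formulae ($\epsilon$ for empty). The calculus $\mathsf{LNS}_\mathsf{Kt}$ has the following rules, where $\mathcal{G}$ is a possibly empty context and $\ast$ stands for either $\nearrow$ or $\swarrow$ (premisses before "/", conclusion after): $\Box_R^1$: $\mathcal{G}\ast\Gamma\Rightarrow\Delta,A\swarrow\Sigma\Rightarrow\Pi,\Box A$ and $\mathcal{G}\ast\Gamma\Rightarrow\Delta\swarrow\Sigma\Rightarrow\Pi,\Box A\nearrow\epsilon\Rightarrow A$ / $\mathcal{G}\ast\Gamma\Rightarrow\Delta\swarrow\Sigma\Rightarrow\Pi,\Box A$; $\blacksquare_R^1$: $\mathcal{G}\ast\Gamma\Rightarrow\Delta,A\nearrow\Sigma\Rightarrow\Pi,\blacksquare A$ and $\mathcal{G}\ast\Gamma\Rightarrow\Delta\nearrow\Sigma\Rightarrow\Pi,\blacksquare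 A\swarrow\epsilon\Rightarrow A$ / $\mathcal{G}\ast\Gamma\Rightarrow\Delta\nearrow\Sigma\Rightarrow\Pi,\blacksquare A$; $\Box_R^2$: $\mathcal{G}\nearrow\Gamma\Rightarrow\Delta,\Box A\nearrow\epsilon\Rightarrow A$ / $\mathcal{G}\nearrow\Gamma\Rightarrow\Delta,\Box A$; $\blacksquare_R^2$: $\mathcal{G}\swarrow\Gamma\Rightarrow\Delta,\blacksquare A\swarrow\epsilon\Rightarrow A$ / $\mathcal{G}\swarrow\Gamma\Rightarrow\Delta,\blacksquare A$; $\Box_L^1$: $\mathcal{G}\ast\Gamma,\Box A\Rightarrow\Delta\nearrow\Sigma,A\Rightarrow\Pi$ / $\mathcal{G}\ast\Gamma,\Box A\Rightarrow\Delta\nearrow\Sigma\Rightarrow\Pi$; $\blacksquare_L^1$: $\mathcal{G}\ast\Gamma,\blacksquare A\Rightarrow\Delta\swarrow\Sigma,A\Rightarrow\Pi$ / $\mathcal{G}\ast\Gamma,\blacksquare A\Rightarrow\Delta\swarrow\Sigma\Rightarrow\Pi$; $\Box_L^2$: $\mathcal{G}\ast\Gamma,A\Rightarrow\Delta$ / $\mathcal{G}\ast\Gamma\Rightarrow\Delta\swarrow\Sigma,\Box A\Rightarrow\Pi$; $\blacksquare_L^2$: $\mathcal{G}\ast\Gamma,A\Rightarrow\Delta$ / $\mathcal{G}\ast\Gamma\Rightarrow\Delta\nearrow\Sigma,\blacksquare A\Rightarrow\Pi$; (id): $\mathcal{G}\ast\Gamma,p\Rightarrow p,\Delta$; $\bot_L$: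 $\mathcal{G}\ast\Gamma,\bot\Rightarrow\Delta$; $\mathsf{EW}$: $\mathcal{G}$ / $\mathcal{G}\ast\Gamma\Rightarrow\Delta$; $\to_R$: $\mathcal{G}\ast\Gamma,A\Rightarrow\Delta,A\to B,B$ / $\mathcal{G}\ast\Gamma\Rightarrow\Delta,A\to B$; $\to_L$: $\mathcal{G}\ast\Gamma,A\to B,B\Rightarrow\Delta$ and $\mathcal{G}\ast\Gamma,A\to B\Rightarrow\Delta,A$ / $\mathcal{G}\ast\Gamma,A\to B\Rightarrow\Delta$. The calculus $\mathsf{LNS}_\mathsf{Kt}^*$ is obtained from $\mathsf{LNS}_\mathsf{Kt}$ by replacing $\Box_R^1,\blacksquare_R^1,\Box_R^2,\blacksquare_R^2$ with the two rules $\Box_R$: $\mathcal{G}\ast\Gamma\Rightarrow\Delta,\Box A\nearrow\epsilon\Rightarrow A$ / $\mathcal{G}\ast\Gamma\Rightarrow\Delta,\Box A$ and $\blacksquare_R$: $\mathcal{G}\ast\Gamma\Rightarrow\Delta,\blacksquare A\swarrow\epsilon\Rightarrow A$ / $\mathcal{G}\ast\Gamma\Rightarrow\Delta,\blacksquare A$. -}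

module Defs where

open import Data.Nat using (ℕ)
open import Data.List using (List; []; _∷_)
open import Data.Product using (_×_; _,_)
open import Data.Maybe using (Maybe; nothing; just)
open import Data.Empty using (⊥)
open import Relation.Nullary using (¬_)
open import Data.List.Relation.Binary.Permutation.Propositional using (_↭_)

infixr 6 _⊃_

data Fml : Set where
  atom : ℕ → Fml
  ⊥'   : Fml
  _⊃_  : Fml → Fml → Fml
  □    : Fml → Fml
  ■    : Fml → Fml

¬' : Fml → Fml
¬' A = A ⊃ ⊥'

◇ : Fml → Fml
◇ A = ¬' (□ (¬' A))

◇⁻¹ : Fml → Fml
◇⁻¹ A = ¬' (■ (¬' A))

-- Atoms are interpreted doubly negated, so that truth is ¬¬-stable and
-- the (constructive) forcing relation coincides with the classical one
-- under excluded middle (Gödel–Gentzen reading).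

record Model : Set₁ where
  field
    W : Set
    R : W → W → Set
    V : ℕ → W → Set

open Model

_,_⊨_ : (M : Model) → W M → Fml → Set
M , w ⊨ atom p = ¬ ¬ V M p w
M , w ⊨ ⊥' = ⊥
M , w ⊨ (A ⊃ B) = M , w ⊨ A → M , w ⊨ B
M , w ⊨ □ A = ∀ v → R M w v → M , v ⊨ A
M , w ⊨ ■ A = ∀ v → R M v w → M , v ⊨ A

Valid : Fml → Set₁
Valid A = (M : Model) (w : W M) → M , w ⊨ A

-- Linear nested sequents.  Components Γ ⇒ Δ with Γ, Δ finite multisets,
-- represented as lists together with an exchange rule (permutation
-- in any component).

record Seq : Set where
  constructor _⇒_
  field
    ant : List Fml
    suc : List Fml

infix 4 _⇒_
infix 3 _⊕_ _⊕↗_ _⊕↙_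
infix 1 _⊢_

data Dir : Set where
  ↗ ↙ : Dir

data LNS : Set where
  [_]   : Seq → LNS
  _⟨_⟩_ : LNS → Dir → Seq → LNS

infixl 2 _⟨_⟩_

-- "𝒢 ∗ Γ⇒Δ" with 𝒢 possibly empty
Ctx : Set
Ctx = Maybe (LNS × Dir)

_⊕_ : Ctx → Seq → LNS
nothing ⊕ s = [ s ]
just (G , d) ⊕ s = G ⟨ d ⟩ s

-- "𝒢 ↗ Γ⇒Δ" / "𝒢 ↙ Γ⇒Δ" with 𝒢 possibly empty
_⊕↗_ : Maybe LNS → Seq → LNS
nothing ⊕↗ s = [ s ]
just G ⊕↗ s = G ⟨ ↗ ⟩ s

_⊕↙_ : Maybe LNS → Seq → LNS
nothing ⊕↙ s = [ s ]
just G ⊕↙ s = G ⟨ ↙ ⟩ s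

data _≈_ : LNS → LNS → Set where
  base : ∀ {Γ Γ' Δ Δ'} → Γ ↭ Γ' → Δ ↭ Δ' → [ Γ ⇒ Δ ] ≈ [ Γ' ⇒ Δ' ]
  step : ∀ {S S' d Γ Γ' Δ Δ'} → S ≈ S' → Γ ↭ Γ' → Δ ↭ Δ' →
         (S ⟨ d ⟩ (Γ ⇒ Δ)) ≈ (S' ⟨ d ⟩ (Γ' ⇒ Δ'))

data Calc : Set where
  Kt Kt* : Calc

private
  variable
    c : Calc
    g : Ctx
    h : Maybe LNS
    S S' : LNS
    d : Dir
    Γ Δ Σ' Π : List Fml
    A B : Fml
    p : ℕ

data _⊢_ : Calc → LNS → Set where
  exch : S ≈ S' → c ⊢ S' → c ⊢ S
  idr  : c ⊢ g ⊕ (atom p ∷ Γ ⇒ atom p ∷ Δ)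
  ⊥L   : c ⊢ g ⊕ (⊥' ∷ Γ ⇒ Δ)
  EW   : c ⊢ S → c ⊢ S ⟨ d ⟩ (Γ ⇒ Δ)
  ⊃R   : c ⊢ g ⊕ (A ∷ Γ ⇒ B ∷ (A ⊃ B) ∷ Δ) → c ⊢ g ⊕ (Γ ⇒ (A ⊃ B) ∷ Δ)
  ⊃L   : c ⊢ g ⊕ (B ∷ (A ⊃ B) ∷ Γ ⇒ Δ) → c ⊢ g ⊕ ((A ⊃ B) ∷ Γ ⇒ A ∷ Δ) →
         c ⊢ g ⊕ ((A ⊃ B) ∷ Γ ⇒ Δ)
  □L1  : c ⊢ g ⊕ (□ A ∷ Γ ⇒ Δ) ⟨ ↗ ⟩ (A ∷ Σ' ⇒ Π) →
         c ⊢ g ⊕ (□ A ∷ Γ ⇒ Δ) ⟨ ↗ ⟩ (Σ' ⇒ Π)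
  ■L1  : c ⊢ g ⊕ (■ A ∷ Γ ⇒ Δ) ⟨ ↙ ⟩ (A ∷ Σ' ⇒ Π) →
         c ⊢ g ⊕ (■ A ∷ Γ ⇒ Δ) ⟨ ↙ ⟩ (Σ' ⇒ Π)
  □L2  : c ⊢ g ⊕ (A ∷ Γ ⇒ Δ) → c ⊢ g ⊕ (Γ ⇒ Δ) ⟨ ↙ ⟩ (□ A ∷ Σ' ⇒ Π)
  ■L2  : c ⊢ g ⊕ (A ∷ Γ ⇒ Δ) → c ⊢ g ⊕ (Γ ⇒ Δ) ⟨ ↗ ⟩ (■ A ∷ Σ' ⇒ Π)
  □R1  : Kt ⊢ g ⊕ (Γ ⇒ A ∷ Δ) ⟨ ↙ ⟩ (Σ' ⇒ □ A ∷ Π) →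
         Kt ⊢ g ⊕ (Γ ⇒ Δ) ⟨ ↙ ⟩ (Σ' ⇒ □ A ∷ Π) ⟨ ↗ ⟩ ([] ⇒ A ∷ []) →
         Kt ⊢ g ⊕ (Γ ⇒ Δ) ⟨ ↙ ⟩ (Σ' ⇒ □ A ∷ Π)
  ■R1  : Kt ⊢ g ⊕ (Γ ⇒ A ∷ Δ) ⟨ ↗ ⟩ (Σ' ⇒ ■ A ∷ Π) →
         Kt ⊢ g ⊕ (Γ ⇒ Δ) ⟨ ↗ ⟩ (Σ' ⇒ ■ A ∷ Π) ⟨ ↙ ⟩ ([] ⇒ A ∷ []) →
         Kt ⊢ g ⊕ (Γ ⇒ Δ) ⟨ ↗ ⟩ (Σ' ⇒ ■ A ∷ Π)
  □R2  : Kt ⊢ h ⊕↗ (Γ ⇒ □ A ∷ Δ) ⟨ ↗ ⟩ ([] ⇒ A ∷ []) →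
         Kt ⊢ h ⊕↗ (Γ ⇒ □ A ∷ Δ)
  ■R2  : Kt ⊢ h ⊕↙ (Γ ⇒ ■ A ∷ Δ) ⟨ ↙ ⟩ ([] ⇒ A ∷ []) →
         Kt ⊢ h ⊕↙ (Γ ⇒ ■ A ∷ Δ)
  □R   : Kt* ⊢ g ⊕ (Γ ⇒ □ A ∷ Δ) ⟨ ↗ ⟩ ([] ⇒ A ∷ []) →
         Kt* ⊢ g ⊕ (Γ ⇒ □ A ∷ Δ)
  ■R   : Kt* ⊢ g ⊕ (Γ ⇒ ■ A ∷ Δ) ⟨ ↙ ⟩ ([] ⇒ A ∷ []) →
         Kt* ⊢ g ⊕ (Γ ⇒ ■ A ∷ Δ)

CutFreeComplete : Calc → Set₁
CutFreeComplete c = (A : Fml) → Valid A → c ⊢ [ [] ⇒ A ∷ [] ]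

module Submission where

open import Data.Maybe using (nothing; just)
open import Data.Product using (_,_)
open import Defs

-- The second premiss of □R1/■R1 is already the premiss of □R/■R, so the
-- first premiss is simply dropped; □R2/■R2 are the instances of □R/■R
-- whose context ends in ↗ resp. ↙.
Kt⊢⇒Kt*⊢ : ∀ {S} → Kt ⊢ S → Kt* ⊢ S
Kt⊢⇒Kt*⊢ (exch S≈S' d) = exch S≈S' (Kt⊢⇒Kt*⊢ d)
Kt⊢⇒Kt*⊢ idr = idr
Kt⊢⇒Kt*⊢ ⊥L = ⊥L
Kt⊢⇒Kt*⊢ (EW d) = EW (Kt⊢⇒Kt*⊢ d)
Kt⊢⇒Kt*⊢ (⊃R d) = ⊃R (Kt⊢⇒Kt*⊢ d)
Kt⊢⇒Kt*⊢ (⊃L d e) = ⊃L (Kt⊢⇒Kt*⊢ d) (Kt⊢⇒Kt*⊢ e)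
Kt⊢⇒Kt*⊢ (□L1 d) = □L1 (Kt⊢⇒Kt*⊢ d)
Kt⊢⇒Kt*⊢ (■L1 d) = ■L1 (Kt⊢⇒Kt*⊢ d)
Kt⊢⇒Kt*⊢ (□L2 {g = g} d) = □L2 {g = g} (Kt⊢⇒Kt*⊢ d)
Kt⊢⇒Kt*⊢ (■L2 {g = g} d) = ■L2 {g = g} (Kt⊢⇒Kt*⊢ d)
Kt⊢⇒Kt*⊢ (□R1 _ e) = □R (Kt⊢⇒Kt*⊢ e)
Kt⊢⇒Kt*⊢ (■R1 _ e) = ■R (Kt⊢⇒Kt*⊢ e)
Kt⊢⇒Kt*⊢ (□R2 {h = nothing} d) = □R {g = nothing} (Kt⊢⇒Kt*⊢ d)
Kt⊢⇒Kt*⊢ (□R2 {h = just G} d) = □R {g = just (G , ↗)} (Kt⊢⇒Kt*⊢ d)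
Kt⊢⇒Kt*⊢ (■R2 {h = nothing} d) = ■R {g = nothing} (Kt⊢⇒Kt*⊢ d)
Kt⊢⇒Kt*⊢ (■R2 {h = just G} d) = ■R {g = just (G , ↙)} (Kt⊢⇒Kt*⊢ d)

proposition6 : CutFreeComplete Kt → CutFreeComplete Kt*
proposition6 complete A valid = Kt⊢⇒Kt*⊢ (complete A valid)
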